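{- Let $n, k \ge 1$, $m \ge 0$ be integers and $0 \le j \le n-1$. Then \[ [q^{mn+j}]\begin{bmatrix} n+k \\ k \end{bmatrix}_q = p_{\le k}(mn+j) - \sum_{i=1}^{m} \#\mathcal{P}^{\mathrm{bad}}_{i,m}(j), \] where $\mathcal{P}^{\mathrm{bad}}_{i,m}(j)$ is the set of pairs of partitions $(\lambda,\mu)$ such that $|\lambda| + |\mu| = mn+j$; $\lambda$ has at most $k$ parts, each at most $n$, and at least $i$ of its parts (its $i$ largest parts) are equal to $n$; and $\mu$ has exactly $i$ parts.
   Context: The Gaussian polynomial is $\begin{bmatrix} n \\ k \end{bmatrix}_q = \frac{[n]!}{[n-k]!\,[k]!}$ with $[m]! = \prod_{i=1}^{m} \frac{1-q^i}{1-q}$; $[q^\alpha]f$ is the coefficient of $q^\alpha$ in $f$. $p_{\le k}(t)$ is the number of partitions of $t$ with at most $k$ parts; $|\lambda|$ is the size of a partition $\lambda$. -}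

module Defs where

open import Data.Nat as ℕ using (ℕ; zero; suc; _≤_; _<_; _∸_; _<ᵇ_)
open import Data.Bool using (if_then_else_)
open import Data.Integer as ℤ using (ℤ; +_)
open import Data.List using (List; length; take)
open import Data.Nat.ListAction using (sum)
open import Data.List.Relation.Unary.All using (All)
open import Data.List.Relation.Unary.Linked using (Linked)
open import Data.Product using (Σ; _×_; _,_)
open import Relation.Binary.PropositionalEquality using (_≡_)

-- Formal power series in q with integer coefficients: f t = [q^t] f.

Series : Set
Series = ℕ → ℤ

sumTo : ℕ → (ℕ → ℤ) → ℤ
sumTo zero    f = f zero
sumTo (suc t) f = sumTo t f ℤ.+ f (suc t)

_⋆_ : Series → Series → Series
(f ⋆ g) t = sumTo t (λ a → f a ℤ.* g (t ∸ a))

oneS : Series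
oneS zero    = + 1
oneS (suc _) = + 0

-- [i] = (1 - q^i)/(1 - q) = 1 + q + ... + q^(i-1)
qint : ℕ → Series
qint i t = if t <ᵇ i then + 1 else + 0

qfact : ℕ → Series
qfact zero    = oneS
qfact (suc m) = qfact m ⋆ qint (suc m)

-- G is the Gaussian polynomial [N choose K]_q = [N]! / ([N-K]! [K]!),
-- i.e. G · [N-K]! · [K]! = [N]! (division in the integral domain ℤ[[q]]).
IsGaussian : ℕ → ℕ → Series → Set
IsGaussian N K G = ∀ t → ((G ⋆ qfact (N ∸ K)) ⋆ qfact K) t ≡ qfact N t

IsPartition : List ℕ → Set
IsPartition xs = Linked (λ a b → b ≤ a) xs × All (λ x → 1 ≤ x) xs

PartitionsAtMost : ℕ → ℕ → Set
PartitionsAtMost k t =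
  Σ (List ℕ) λ λs → IsPartition λs × length λs ≤ k × sum λs ≡ t

-- 𝒫^bad_{i,m}(j) for given n, k  (total size s = m n + j)
Bad : (n k i s : ℕ) → Set
Bad n k i s =
  Σ (List ℕ × List ℕ) λ { (λs , μs) →
      IsPartition λs × IsPartition μs
    × sum λs ℕ.+ sum μs ≡ s
    × length λs ≤ k
    × All (λ x → x ≤ n) λs
    × i ≤ length λs
    × All (λ x → x ≡ n) (take i λs)
    × length μs ≡ i }

sum1to : ℕ → (ℕ → ℤ) → ℤ
sum1to zero    f = + 0
sum1to (suc m) f = sum1to m f ℤ.+ f (suc m)

{-# OPTIONS --safe #-}
-- The Gaussian polynomial [n+k choose k]_q is the generating function box(n,k) of partitions
-- with at most k parts, each at most n. Splitting off a part equal to the width gives the q-Pascal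
-- recurrence box(a+1,b+1) = box(a,b+1) + q^(a+1) box(a+1,b), which together with [a+b+2] = [a+1] + q^(a+1) [b+1]
-- yields box(a,b) [a]! [b]! = [a+b]!, and [a]! [b]! has constant term 1, so it can be cancelled.
--
-- A partition of mn + j (j < n) with at most k parts has at most m parts exceeding n, since
-- (m+1)(n+1) > mn + j. Those with no such part lie in the box; those with exactly i ≥ 1 such parts,
-- necessarily the i largest, correspond bijectively to 𝒫^bad_{i,m}(j) by lowering these parts
-- to n (giving λ) and keeping their excesses over n (giving μ). Hence p = box(n,k)_{mn+j} + Σ b_i.
module Submission where

open import Defs
open import Data.Nat using (ℕ; _≤_; _<_; _+_; _*_)
open import Data.Integer using (ℤ; +_; _-_)
open import Data.Fin using (Fin)
open import Function.Bundles using (_↔_)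
open import Relation.Binary.PropositionalEquality using (_≡_)

open import Data.Nat using (zero; suc; _∸_; z≤n; s≤s; _≤?_; _<?_)
import Data.Nat.Properties as ℕP
open import Data.Nat.Induction using (<-rec)
import Data.Integer as ℤ
import Data.Integer.Properties as ℤP
open import Algebra.Properties.CommutativeSemigroup ℤP.+-commutativeSemigroup
  using () renaming (interchange to ℤ+-interchange)
open import Algebra.Properties.CommutativeSemigroup ℕP.+-commutativeSemigroup
  using () renaming (interchange to ℕ+-interchange)
open import Algebra.Properties.AbelianGroup ℤP.+-0-abelianGroup using (∙-cancelʳ; x≈z//y)
open import Data.List using (List; []; _∷_; length; take; drop)
open import Data.Nat.ListAction using (sum)
open import Data.List.Relation.Unary.All as All using (All; []; _∷_)
open import Data.List.Relation.Unary.Linked as Linked using (Linked; []; [-]; _∷_)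
open import Data.List.Relation.Unary.Linked.Properties using (Linked⇒All)
open import Data.Product using (Σ; _×_; _,_; proj₁; proj₂)
open import Data.Sum using (_⊎_; inj₁; inj₂; [_,_]′; map₁)
open import Data.Empty using (⊥; ⊥-elim)
open import Data.Fin using (zero)
import Data.Fin.Properties as FinP
open import Data.Fin.Permutation using (↔⇒≡)
open import Function using (_∘_)
open import Function.Bundles using (mk↔ₛ′)
open import Function.Properties.Inverse using (↔-refl; ↔-trans; ↔-sym)
open import Function.Related.TypeIsomorphisms using (Σ-distribˡ-⊎; ×-distribˡ-⊎)
open import Data.Product.Function.Dependent.Propositional using (Σ-↔)
open import Data.Product.Function.NonDependent.Propositional using (_×-↔_)
open import Data.Sum.Function.Propositional using (_⊎-↔_)
open import Relation.Nullary using (Irrelevant; ¬_; yes; no)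
open import Relation.Binary.PropositionalEquality
open ≡-Reasoning

-- Power series

infixl 6 _⊕_
infix  8 q^_·_

_⊕_ : Series → Series → Series
(f ⊕ g) t = f t ℤ.+ g t

shift : {A : Set} → A → ℕ → (ℕ → A) → ℕ → A
shift z zero    f t       = f t
shift z (suc i) f zero    = z
shift z (suc i) f (suc t) = shift z i f t

q^_·_ : ℕ → Series → Series
q^ i · f = shift (+ 0) i f

shift-map : {A B : Set} (g : A → B) {z : A} {z′ : B} → g z ≡ z′ →
            ∀ i f t → g (shift z i f t) ≡ shift z′ i (g ∘ f) t
shift-map g g0 zero    f t       = refl
shift-map g g0 (suc i) f zero    = g0
shift-map g g0 (suc i) f (suc t) = shift-map g g0 i f t


sumTo-cong : ∀ t {f g : ℕ → ℤ} → (∀ a → a ≤ t → f a ≡ g a) → sumTo t f ≡ sumTo t g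
sumTo-cong zero    f≡g = f≡g 0 z≤n
sumTo-cong (suc t) f≡g =
  cong₂ ℤ._+_ (sumTo-cong t (λ a a≤t → f≡g a (ℕP.m≤n⇒m≤1+n a≤t))) (f≡g (suc t) ℕP.≤-refl)

sumTo-zero : ∀ t → sumTo t (λ _ → + 0) ≡ + 0
sumTo-zero zero    = refl
sumTo-zero (suc t) = cong (ℤ._+ + 0) (sumTo-zero t)

sumTo-+ : ∀ t f g → sumTo t (λ a → f a ℤ.+ g a) ≡ sumTo t f ℤ.+ sumTo t g
sumTo-+ zero    f g = refl
sumTo-+ (suc t) f g = trans (cong (ℤ._+ (f (suc t) ℤ.+ g (suc t))) (sumTo-+ t f g))
                            (ℤ+-interchange (sumTo t f) (sumTo t g) (f (suc t)) (g (suc t)))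

sumTo-*ˡ : ∀ t c f → sumTo t (λ a → c ℤ.* f a) ≡ c ℤ.* sumTo t f
sumTo-*ˡ zero    c f = refl
sumTo-*ˡ (suc t) c f = trans (cong (ℤ._+ c ℤ.* f (suc t)) (sumTo-*ˡ t c f))
                             (sym (ℤP.*-distribˡ-+ c (sumTo t f) (f (suc t))))

sumTo-*ʳ : ∀ t c f → sumTo t (λ a → f a ℤ.* c) ≡ sumTo t f ℤ.* c
sumTo-*ʳ t c f = begin
  sumTo t (λ a → f a ℤ.* c) ≡⟨ sumTo-cong t (λ a _ → ℤP.*-comm (f a) c) ⟩
  sumTo t (λ a → c ℤ.* f a) ≡⟨ sumTo-*ˡ t c f ⟩
  c ℤ.* sumTo t f           ≡⟨ ℤP.*-comm c (sumTo t f) ⟩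
  sumTo t f ℤ.* c           ∎

sumTo-suc : ∀ t f → sumTo (suc t) f ≡ f 0 ℤ.+ sumTo t (f ∘ suc)
sumTo-suc zero    f = refl
sumTo-suc (suc t) f = trans (cong (ℤ._+ f (2 + t)) (sumTo-suc t f))
                            (ℤP.+-assoc (f 0) (sumTo t (f ∘ suc)) (f (2 + t)))

sumTo-reverse : ∀ t f → sumTo t f ≡ sumTo t (λ a → f (t ∸ a))
sumTo-reverse zero    f = refl
sumTo-reverse (suc t) f = begin
  sumTo t f ℤ.+ f (suc t)                 ≡⟨ cong (ℤ._+ f (suc t)) (sumTo-reverse t f) ⟩
  sumTo t (λ a → f (t ∸ a)) ℤ.+ f (suc t) ≡⟨ ℤP.+-comm _ (f (suc t)) ⟩
  f (suc t) ℤ.+ sumTo t (λ a → f (t ∸ a)) ≡⟨ sumTo-suc t (λ a → f (suc t ∸ a)) ⟨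
  sumTo (suc t) (λ a → f (suc t ∸ a))     ∎

sumTo-triangle : ∀ t (F : ℕ → ℕ → ℤ) →
  sumTo t (λ u → sumTo u (λ a → F a u)) ≡ sumTo t (λ a → sumTo (t ∸ a) (λ b → F a (a + b)))
sumTo-triangle zero    F = refl
sumTo-triangle (suc t) F = begin
  sumTo t (λ u → sumTo u (λ a → F a u)) ℤ.+ (sumTo t (λ a → F a (suc t)) ℤ.+ F (suc t) (suc t))
    ≡⟨ cong (ℤ._+ (sumTo t (λ a → F a (suc t)) ℤ.+ F (suc t) (suc t))) (sumTo-triangle t F) ⟩
  inner t ℤ.+ (sumTo t (λ a → F a (suc t)) ℤ.+ F (suc t) (suc t))
    ≡⟨ ℤP.+-assoc (inner t) _ _ ⟨
  (inner t ℤ.+ sumTo t (λ a → F a (suc t))) ℤ.+ F (suc t) (suc t)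
    ≡⟨ cong₂ ℤ._+_ (sym (sumTo-+ t _ _)) (cong (F (suc t)) (sym (ℕP.+-identityʳ (suc t)))) ⟩
  sumTo t (λ a → sumTo (t ∸ a) (λ b → F a (a + b)) ℤ.+ F a (suc t)) ℤ.+ F (suc t) (suc t + 0)
    ≡⟨ cong₂ ℤ._+_ (sumTo-cong t extend)
                   (cong (λ z → sumTo z (λ b → F (suc t) (suc t + b))) (sym (ℕP.n∸n≡0 t))) ⟩
  sumTo (suc t) (λ a → sumTo (suc t ∸ a) (λ b → F a (a + b))) ∎
  where
  inner : ℕ → ℤ
  inner t = sumTo t (λ a → sumTo (t ∸ a) (λ b → F a (a + b)))
  extend : ∀ a → a ≤ t →
           sumTo (t ∸ a) (λ b → F a (a + b)) ℤ.+ F a (suc t) ≡ sumTo (suc t ∸ a) (λ b → F a (a + b))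
  extend a a≤t rewrite ℕP.+-∸-assoc 1 a≤t =
    cong (λ z → sumTo (t ∸ a) (λ b → F a (a + b)) ℤ.+ F a z)
         (sym (trans (ℕP.+-suc a (t ∸ a)) (cong suc (ℕP.m+[n∸m]≡n a≤t))))

⋆-cong : ∀ {f f′ g g′} → f ≗ f′ → g ≗ g′ → (f ⋆ g) ≗ (f′ ⋆ g′)
⋆-cong f≗f′ g≗g′ t = sumTo-cong t (λ a _ → cong₂ ℤ._*_ (f≗f′ a) (g≗g′ (t ∸ a)))

⋆-congˡ : ∀ h {f g} → f ≗ g → (f ⋆ h) ≗ (g ⋆ h)
⋆-congˡ h f≗g t = sumTo-cong t (λ a _ → cong (ℤ._* h (t ∸ a)) (f≗g a))

⋆-congʳ : ∀ f {g h} → g ≗ h → (f ⋆ g) ≗ (f ⋆ h)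
⋆-congʳ f g≗h t = sumTo-cong t (λ a _ → cong (ℤ._*_ (f a)) (g≗h (t ∸ a)))

⋆-comm : ∀ f g → (f ⋆ g) ≗ (g ⋆ f)
⋆-comm f g t = begin
  sumTo t (λ a → f a ℤ.* g (t ∸ a))           ≡⟨ sumTo-reverse t _ ⟩
  sumTo t (λ a → f (t ∸ a) ℤ.* g (t ∸ (t ∸ a))) ≡⟨ sumTo-cong t swap ⟩
  sumTo t (λ a → g a ℤ.* f (t ∸ a))           ∎
  where
  swap : ∀ a → a ≤ t → f (t ∸ a) ℤ.* g (t ∸ (t ∸ a)) ≡ g a ℤ.* f (t ∸ a)
  swap a a≤t rewrite ℕP.m∸[m∸n]≡n a≤t = ℤP.*-comm (f (t ∸ a)) (g a)

⋆-assoc : ∀ f g h → ((f ⋆ g) ⋆ h) ≗ (f ⋆ (g ⋆ h))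
⋆-assoc f g h t = begin
  sumTo t (λ u → sumTo u (λ a → f a ℤ.* g (u ∸ a)) ℤ.* h (t ∸ u))
    ≡⟨ sumTo-cong t (λ u _ → sym (sumTo-*ʳ u (h (t ∸ u)) _)) ⟩
  sumTo t (λ u → sumTo u (λ a → f a ℤ.* g (u ∸ a) ℤ.* h (t ∸ u)))
    ≡⟨ sumTo-triangle t (λ a u → f a ℤ.* g (u ∸ a) ℤ.* h (t ∸ u)) ⟩
  sumTo t (λ a → sumTo (t ∸ a) (λ b → f a ℤ.* g (a + b ∸ a) ℤ.* h (t ∸ (a + b))))
    ≡⟨ sumTo-cong t (λ a _ → sumTo-cong (t ∸ a) (λ b _ → reassociate a b)) ⟩
  sumTo t (λ a → sumTo (t ∸ a) (λ b → f a ℤ.* (g b ℤ.* h (t ∸ a ∸ b))))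
    ≡⟨ sumTo-cong t (λ a _ → sumTo-*ˡ (t ∸ a) (f a) _) ⟩
  sumTo t (λ a → f a ℤ.* sumTo (t ∸ a) (λ b → g b ℤ.* h (t ∸ a ∸ b))) ∎
  where
  reassociate : ∀ a b → f a ℤ.* g (a + b ∸ a) ℤ.* h (t ∸ (a + b)) ≡ f a ℤ.* (g b ℤ.* h (t ∸ a ∸ b))
  reassociate a b rewrite ℕP.m+n∸m≡n a b | ℕP.∸-+-assoc t a b = ℤP.*-assoc (f a) (g b) _

⋆-identityˡ : ∀ f → (oneS ⋆ f) ≗ f
⋆-identityˡ f zero    = ℤP.*-identityˡ (f 0)
⋆-identityˡ f (suc t) = begin
  sumTo (suc t) (λ a → oneS a ℤ.* f (suc t ∸ a))          ≡⟨ sumTo-suc t _ ⟩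
  + 1 ℤ.* f (suc t) ℤ.+ sumTo t (λ a → + 0 ℤ.* f (t ∸ a)) ≡⟨ cong₂ ℤ._+_ (ℤP.*-identityˡ (f (suc t))) (sumTo-zero t) ⟩
  f (suc t) ℤ.+ + 0                                       ≡⟨ ℤP.+-identityʳ (f (suc t)) ⟩
  f (suc t)                                               ∎

⋆-identityʳ : ∀ f → (f ⋆ oneS) ≗ f
⋆-identityʳ f t = trans (⋆-comm f oneS t) (⋆-identityˡ f t)

⋆-distribˡ-⊕ : ∀ f g h → (f ⋆ (g ⊕ h)) ≗ ((f ⋆ g) ⊕ (f ⋆ h))
⋆-distribˡ-⊕ f g h t =
  trans (sumTo-cong t (λ a _ → ℤP.*-distribˡ-+ (f a) (g (t ∸ a)) (h (t ∸ a)))) (sumTo-+ t _ _)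

⋆-distribʳ-⊕ : ∀ f g h → ((g ⊕ h) ⋆ f) ≗ ((g ⋆ f) ⊕ (h ⋆ f))
⋆-distribʳ-⊕ f g h t = begin
  ((g ⊕ h) ⋆ f) t         ≡⟨ ⋆-comm (g ⊕ h) f t ⟩
  (f ⋆ (g ⊕ h)) t         ≡⟨ ⋆-distribˡ-⊕ f g h t ⟩
  (f ⋆ g) t ℤ.+ (f ⋆ h) t ≡⟨ cong₂ ℤ._+_ (⋆-comm f g t) (⋆-comm f h t) ⟩
  (g ⋆ f) t ℤ.+ (h ⋆ f) t ∎

⋆-shift₁ : ∀ f g → (f ⋆ (q^ 1 · g)) ≗ (q^ 1 · (f ⋆ g))
⋆-shift₁ f g zero    = ℤP.*-zeroʳ (f 0)
⋆-shift₁ f g (suc t) = begin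
  sumTo t (λ a → f a ℤ.* (q^ 1 · g) (suc t ∸ a)) ℤ.+ f (suc t) ℤ.* (q^ 1 · g) (suc t ∸ suc t)
    ≡⟨ cong₂ ℤ._+_ (sumTo-cong t (λ a a≤t → cong (λ z → f a ℤ.* (q^ 1 · g) z) (ℕP.+-∸-assoc 1 a≤t)))
                   (cong (λ z → f (suc t) ℤ.* (q^ 1 · g) z) (ℕP.n∸n≡0 t)) ⟩
  sumTo t (λ a → f a ℤ.* g (t ∸ a)) ℤ.+ f (suc t) ℤ.* + 0
    ≡⟨ cong (ℤ._+_ (sumTo t (λ a → f a ℤ.* g (t ∸ a)))) (ℤP.*-zeroʳ (f (suc t))) ⟩
  sumTo t (λ a → f a ℤ.* g (t ∸ a)) ℤ.+ + 0
    ≡⟨ ℤP.+-identityʳ _ ⟩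
  sumTo t (λ a → f a ℤ.* g (t ∸ a)) ∎

q^-suc : ∀ i f → (q^ suc i · f) ≗ (q^ 1 · (q^ i · f))
q^-suc i f zero    = refl
q^-suc i f (suc t) = refl

q^-cong : ∀ i {f g} → f ≗ g → (q^ i · f) ≗ (q^ i · g)
q^-cong zero    f≗g t       = f≗g t
q^-cong (suc i) f≗g zero    = refl
q^-cong (suc i) f≗g (suc t) = q^-cong i f≗g t

⋆-shiftʳ : ∀ i f g → (f ⋆ (q^ i · g)) ≗ (q^ i · (f ⋆ g))
⋆-shiftʳ zero    f g t = refl
⋆-shiftʳ (suc i) f g t = begin
  (f ⋆ (q^ suc i · g)) t       ≡⟨ ⋆-congʳ f (q^-suc i g) t ⟩
  (f ⋆ (q^ 1 · (q^ i · g))) t  ≡⟨ ⋆-shift₁ f (q^ i · g) t ⟩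
  (q^ 1 · (f ⋆ (q^ i · g))) t  ≡⟨ q^-cong 1 (⋆-shiftʳ i f g) t ⟩
  (q^ 1 · (q^ i · (f ⋆ g))) t  ≡⟨ q^-suc i (f ⋆ g) t ⟨
  (q^ suc i · (f ⋆ g)) t       ∎

⋆-shiftˡ : ∀ i f g → ((q^ i · f) ⋆ g) ≗ (q^ i · (f ⋆ g))
⋆-shiftˡ i f g t = begin
  ((q^ i · f) ⋆ g) t  ≡⟨ ⋆-comm (q^ i · f) g t ⟩
  (g ⋆ (q^ i · f)) t  ≡⟨ ⋆-shiftʳ i g f t ⟩
  (q^ i · (g ⋆ f)) t  ≡⟨ q^-cong i (⋆-comm g f) t ⟩
  (q^ i · (f ⋆ g)) t  ∎

-- Coefficient t of f ⋆ h is f t · h 0 plus terms involving only f 0, …, f (t - 1).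
⋆-cancelʳ : ∀ h {f g} → h 0 ≡ + 1 → (f ⋆ h) ≗ (g ⋆ h) → f ≗ g
⋆-cancelʳ h {f} {g} h0≡1 fh≗gh = <-rec (λ t → f t ≡ g t) step
  where
  last : ∀ (f : Series) t → f t ℤ.* h (t ∸ t) ≡ f t
  last f t rewrite ℕP.n∸n≡0 t | h0≡1 = ℤP.*-identityʳ (f t)
  step : ∀ t → (∀ {s} → s < t → f s ≡ g s) → f t ≡ g t
  step zero    _  = trans (sym (last f 0)) (trans (fh≗gh 0) (last g 0))
  step (suc t) ih = ∙-cancelʳ (sumTo t (λ a → f a ℤ.* h (suc t ∸ a))) (f (suc t)) (g (suc t)) (begin
    f (suc t) ℤ.+ sumTo t (λ a → f a ℤ.* h (suc t ∸ a))
      ≡⟨ ℤP.+-comm (f (suc t)) _ ⟩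
    sumTo t (λ a → f a ℤ.* h (suc t ∸ a)) ℤ.+ f (suc t)
      ≡⟨ cong (ℤ._+_ (sumTo t (λ a → f a ℤ.* h (suc t ∸ a)))) (last f (suc t)) ⟨
    (f ⋆ h) (suc t)
      ≡⟨ fh≗gh (suc t) ⟩
    (g ⋆ h) (suc t)
      ≡⟨ cong₂ ℤ._+_ (sumTo-cong t (λ a a≤t → cong (ℤ._* h (suc t ∸ a)) (sym (ih (s≤s a≤t))))) (last g (suc t)) ⟩
    sumTo t (λ a → f a ℤ.* h (suc t ∸ a)) ℤ.+ g (suc t)
      ≡⟨ ℤP.+-comm _ (g (suc t)) ⟩
    g (suc t) ℤ.+ sumTo t (λ a → f a ℤ.* h (suc t ∸ a)) ∎)

factor-⊕-q^ : ∀ i X Y P F r s → (X ⋆ P) ≗ (F ⋆ r) → (Y ⋆ P) ≗ (F ⋆ s) →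
              ((X ⊕ (q^ i · Y)) ⋆ P) ≗ (F ⋆ (r ⊕ (q^ i · s)))
factor-⊕-q^ i X Y P F r s X⋆P Y⋆P t = begin
  ((X ⊕ (q^ i · Y)) ⋆ P) t          ≡⟨ ⋆-distribʳ-⊕ P X (q^ i · Y) t ⟩
  (X ⋆ P) t ℤ.+ ((q^ i · Y) ⋆ P) t  ≡⟨ cong₂ ℤ._+_ (X⋆P t) (⋆-shiftˡ i Y P t) ⟩
  (F ⋆ r) t ℤ.+ (q^ i · (Y ⋆ P)) t  ≡⟨ cong (ℤ._+_ ((F ⋆ r) t)) (q^-cong i Y⋆P t) ⟩
  (F ⋆ r) t ℤ.+ (q^ i · (F ⋆ s)) t  ≡⟨ cong (ℤ._+_ ((F ⋆ r) t)) (⋆-shiftʳ i F s t) ⟨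
  (F ⋆ r) t ℤ.+ (F ⋆ (q^ i · s)) t  ≡⟨ ⋆-distribˡ-⊕ F r (q^ i · s) t ⟨
  (F ⋆ (r ⊕ (q^ i · s))) t          ∎

-- The Gaussian polynomial as a generating function of box partitions

qint-+ : ∀ i j → (qint i ⊕ (q^ i · qint j)) ≗ qint (i + j)
qint-+ zero    j t       = ℤP.+-identityˡ (qint j t)
qint-+ (suc i) j zero    = refl
qint-+ (suc i) j (suc t) = qint-+ i j t

qfact-zero : ∀ m → qfact m 0 ≡ + 1
qfact-zero zero    = refl
qfact-zero (suc m) = cong (ℤ._* + 1) (qfact-zero m)

δ₀ : ℕ → ℕ
δ₀ zero    = 1
δ₀ (suc _) = 0

-- Partitions of t with at most b parts, each at most a, split by whether some part equals a.
boxCount : ℕ → ℕ → ℕ → ℕ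
boxCount (suc a) (suc b) t = boxCount a (suc b) t + shift 0 (suc a) (boxCount (suc a) b) t
boxCount _       _       t = δ₀ t

boxSeries : ℕ → ℕ → Series
boxSeries a b t = + boxCount a b t

boxSeries-suc : ∀ a b → boxSeries (suc a) (suc b) ≗ (boxSeries a (suc b) ⊕ (q^ suc a · boxSeries (suc a) b))
boxSeries-suc a b t =
  trans (ℤP.pos-+ (boxCount a (suc b) t) _)
        (cong (ℤ._+_ (boxSeries a (suc b) t)) (shift-map +_ refl (suc a) (boxCount (suc a) b) t))

boxSeries-zeroˡ : ∀ b → boxSeries 0 b ≗ oneS
boxSeries-zeroˡ b zero    = refl
boxSeries-zeroˡ b (suc t) = refl

boxSeries-zeroʳ : ∀ a → boxSeries a 0 ≗ oneS
boxSeries-zeroʳ zero    = boxSeries-zeroˡ 0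
boxSeries-zeroʳ (suc a) zero    = refl
boxSeries-zeroʳ (suc a) (suc t) = refl

qfact-sucˡ : ∀ a g → (qfact (suc a) ⋆ g) ≗ ((qfact a ⋆ g) ⋆ qint (suc a))
qfact-sucˡ a g t = begin
  ((qfact a ⋆ qint (suc a)) ⋆ g) t  ≡⟨ ⋆-assoc (qfact a) (qint (suc a)) g t ⟩
  (qfact a ⋆ (qint (suc a) ⋆ g)) t  ≡⟨ ⋆-congʳ (qfact a) (⋆-comm (qint (suc a)) g) t ⟩
  (qfact a ⋆ (g ⋆ qint (suc a))) t  ≡⟨ ⋆-assoc (qfact a) g (qint (suc a)) t ⟨
  ((qfact a ⋆ g) ⋆ qint (suc a)) t  ∎

boxSeries-gaussian : ∀ a b → (boxSeries a b ⋆ (qfact a ⋆ qfact b)) ≗ qfact (a + b)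
boxSeries-gaussian zero b t = begin
  (boxSeries 0 b ⋆ (oneS ⋆ qfact b)) t  ≡⟨ ⋆-cong (boxSeries-zeroˡ b) (⋆-identityˡ (qfact b)) t ⟩
  (oneS ⋆ qfact b) t                    ≡⟨ ⋆-identityˡ (qfact b) t ⟩
  qfact b t                             ∎
boxSeries-gaussian (suc a) zero t = begin
  (boxSeries (suc a) 0 ⋆ (qfact (suc a) ⋆ oneS)) t  ≡⟨ ⋆-cong (boxSeries-zeroʳ (suc a)) (⋆-identityʳ (qfact (suc a))) t ⟩
  (oneS ⋆ qfact (suc a)) t                          ≡⟨ ⋆-identityˡ (qfact (suc a)) t ⟩
  qfact (suc a) t                                   ≡⟨ cong (λ c → qfact c t) (ℕP.+-identityʳ (suc a)) ⟨
  qfact (suc a + 0) t                               ∎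
boxSeries-gaussian (suc a) (suc b) t = begin
  (boxSeries (suc a) (suc b) ⋆ P) t                         ≡⟨ ⋆-congˡ P (boxSeries-suc a b) t ⟩
  ((X ⊕ (q^ suc a · Y)) ⋆ P) t
    ≡⟨ factor-⊕-q^ (suc a) X Y P (qfact N) (qint (suc a)) (qint (suc b)) X⋆P Y⋆P t ⟩
  (qfact N ⋆ (qint (suc a) ⊕ (q^ suc a · qint (suc b)))) t  ≡⟨ ⋆-congʳ (qfact N) (qint-+ (suc a) (suc b)) t ⟩
  (qfact N ⋆ qint (suc N)) t                                ∎
  where
  X Y P : Series
  X = boxSeries a (suc b)
  Y = boxSeries (suc a) b
  P = qfact (suc a) ⋆ qfact (suc b)
  N : ℕ
  N = a + suc b
  X⋆P : (X ⋆ P) ≗ (qfact N ⋆ qint (suc a))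
  X⋆P u = begin
    (X ⋆ P) u                                           ≡⟨ ⋆-congʳ X (qfact-sucˡ a (qfact (suc b))) u ⟩
    (X ⋆ ((qfact a ⋆ qfact (suc b)) ⋆ qint (suc a))) u  ≡⟨ ⋆-assoc X (qfact a ⋆ qfact (suc b)) (qint (suc a)) u ⟨
    ((X ⋆ (qfact a ⋆ qfact (suc b))) ⋆ qint (suc a)) u  ≡⟨ ⋆-congˡ (qint (suc a)) (boxSeries-gaussian a (suc b)) u ⟩
    (qfact N ⋆ qint (suc a)) u                          ∎
  Y⋆P : (Y ⋆ P) ≗ (qfact N ⋆ qint (suc b))
  Y⋆P u = begin
    (Y ⋆ P) u                                           ≡⟨ ⋆-congʳ Y (⋆-assoc (qfact (suc a)) (qfact b) (qint (suc b))) u ⟨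
    (Y ⋆ ((qfact (suc a) ⋆ qfact b) ⋆ qint (suc b))) u  ≡⟨ ⋆-assoc Y (qfact (suc a) ⋆ qfact b) (qint (suc b)) u ⟨
    ((Y ⋆ (qfact (suc a) ⋆ qfact b)) ⋆ qint (suc b)) u  ≡⟨ ⋆-congˡ (qint (suc b)) (boxSeries-gaussian (suc a) b) u ⟩
    (qfact (suc a + b) ⋆ qint (suc b)) u                ≡⟨ cong (λ c → (qfact c ⋆ qint (suc b)) u) (ℕP.+-suc a b) ⟨
    (qfact N ⋆ qint (suc b)) u                          ∎

gaussian≗boxSeries : ∀ n k G → IsGaussian (n + k) k G → G ≗ boxSeries n k
gaussian≗boxSeries n k G isG = ⋆-cancelʳ (qfact n ⋆ qfact k) constant-one Gp≗Bp
  where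
  constant-one : (qfact n ⋆ qfact k) 0 ≡ + 1
  constant-one rewrite qfact-zero n | qfact-zero k = refl
  Gp≗Bp : (G ⋆ (qfact n ⋆ qfact k)) ≗ (boxSeries n k ⋆ (qfact n ⋆ qfact k))
  Gp≗Bp t = begin
    (G ⋆ (qfact n ⋆ qfact k)) t              ≡⟨ ⋆-assoc G (qfact n) (qfact k) t ⟨
    ((G ⋆ qfact n) ⋆ qfact k) t              ≡⟨ cong (λ m → ((G ⋆ qfact m) ⋆ qfact k) t) (ℕP.m+n∸n≡m n k) ⟨
    ((G ⋆ qfact (n + k ∸ k)) ⋆ qfact k) t    ≡⟨ isG t ⟩
    qfact (n + k) t                          ≡⟨ boxSeries-gaussian n k t ⟨
    (boxSeries n k ⋆ (qfact n ⋆ qfact k)) t  ∎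

-- Counting by bijections with Fin

×-irrelevant : {A B : Set} → Irrelevant A → Irrelevant B → Irrelevant (A × B)
×-irrelevant irrA irrB (a , b) (a′ , b′) = cong₂ _,_ (irrA a a′) (irrB b b′)

⊎-irrelevant : {A B : Set} → Irrelevant A → Irrelevant B → (A → ¬ B) → Irrelevant (A ⊎ B)
⊎-irrelevant irrA irrB disjoint (inj₁ a) (inj₁ a′) = cong inj₁ (irrA a a′)
⊎-irrelevant irrA irrB disjoint (inj₁ a) (inj₂ b)  = ⊥-elim (disjoint a b)
⊎-irrelevant irrA irrB disjoint (inj₂ b) (inj₁ a)  = ⊥-elim (disjoint a b)
⊎-irrelevant irrA irrB disjoint (inj₂ b) (inj₂ b′) = cong inj₂ (irrB b b′)

irrelevant-↔ : {A B : Set} → Irrelevant A → Irrelevant B → (A → B) → (B → A) → A ↔ B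
irrelevant-↔ irrA irrB to from = mk↔ₛ′ to from (λ b → irrB _ b) (λ a → irrA _ a)

Σ-congʳ-↔ : {A : Set} {P Q : A → Set} → (∀ {a} → P a ↔ Q a) → Σ A P ↔ Σ A Q
Σ-congʳ-↔ P↔Q = Σ-↔ ↔-refl P↔Q

⊎-↔-Fin : {A B : Set} {m n : ℕ} → A ↔ Fin m → B ↔ Fin n → (A ⊎ B) ↔ Fin (m + n)
⊎-↔-Fin A↔m B↔n = ↔-trans (A↔m ⊎-↔ B↔n) (↔-sym FinP.+↔⊎)

≤-suc-↔ : ∀ {m n} → m ≤ suc n ↔ (m ≤ n ⊎ m ≡ suc n)
≤-suc-↔ = irrelevant-↔ ℕP.≤-irrelevant
  (⊎-irrelevant ℕP.≤-irrelevant ℕP.≡-irrelevant (λ m≤n m≡1+n → ℕP.<-irrefl m≡1+n (s≤s m≤n)))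
  (map₁ ℕP.≤-pred ∘ ℕP.m≤n⇒m<n∨m≡n) [ ℕP.m≤n⇒m≤1+n , ℕP.≤-reflexive ]′

≤-zero-↔ : ∀ {m} → m ≤ 0 ↔ m ≡ 0
≤-zero-↔ = irrelevant-↔ ℕP.≤-irrelevant ℕP.≡-irrelevant ℕP.n≤0⇒n≡0 ℕP.≤-reflexive

sumUpTo : ℕ → (ℕ → ℕ) → ℕ
sumUpTo zero    f = f 0
sumUpTo (suc m) f = sumUpTo m f + f (suc m)

Σ-classes-↔ : {A : Set} {P : A → Set} (c : A → ℕ) (f : ℕ → ℕ) (m : ℕ) →
              (∀ i → i ≤ m → Σ A (λ a → P a × c a ≡ i) ↔ Fin (f i)) →
              Σ A (λ a → P a × c a ≤ m) ↔ Fin (sumUpTo m f)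
Σ-classes-↔ c f zero    classes = ↔-trans (Σ-congʳ-↔ (↔-refl ×-↔ ≤-zero-↔)) (classes 0 z≤n)
Σ-classes-↔ c f (suc m) classes =
  ↔-trans (Σ-congʳ-↔ (↔-trans (↔-refl ×-↔ ≤-suc-↔) ×-distribˡ-⊎))
  (↔-trans Σ-distribˡ-⊎
  (⊎-↔-Fin (Σ-classes-↔ c f m (λ i i≤m → classes i (ℕP.m≤n⇒m≤1+n i≤m)))
           (classes (suc m) ℕP.≤-refl)))

Σ-≡-irrelevant : {A : Set} {P : A → Set} → (∀ {a} → Irrelevant (P a)) →
                 ∀ {a b} {p : P a} {q : P b} → a ≡ b → (a , p) ≡ (b , q)
Σ-≡-irrelevant irr {p = p} {q} refl = cong (_ ,_) (irr p q)

-- Partitions in a box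

Decreasing : List ℕ → Set
Decreasing = Linked (λ a b → b ≤ a)

decreasing-head : ∀ {x xs} → Decreasing (x ∷ xs) → All (_≤ x) xs
decreasing-head lk = All.tail (Linked⇒All (λ b≤a c≤b → ℕP.≤-trans c≤b b≤a) ℕP.≤-refl lk)

decreasing-cons : ∀ {x xs} → All (_≤ x) xs → Decreasing xs → Decreasing (x ∷ xs)
decreasing-cons []        [] = [-]
decreasing-cons (y≤x ∷ _) lk = y≤x ∷ lk

isPartition-irrelevant : ∀ {xs} → Irrelevant (IsPartition xs)
isPartition-irrelevant = ×-irrelevant (Linked.irrelevant ℕP.≤-irrelevant) (All.irrelevant ℕP.≤-irrelevant)

IsPartitionAtMost : ℕ → ℕ → List ℕ → Set
IsPartitionAtMost k t xs = IsPartition xs × length xs ≤ k × sum xs ≡ t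

isPartitionAtMost-irrelevant : ∀ {k t xs} → Irrelevant (IsPartitionAtMost k t xs)
isPartitionAtMost-irrelevant =
  ×-irrelevant isPartition-irrelevant (×-irrelevant ℕP.≤-irrelevant ℕP.≡-irrelevant)

IsBoxPartition : ℕ → ℕ → ℕ → List ℕ → Set
IsBoxPartition a b t xs = IsPartitionAtMost b t xs × All (_≤ a) xs

BoxPartitions : ℕ → ℕ → ℕ → Set
BoxPartitions a b t = Σ (List ℕ) (IsBoxPartition a b t)

isBoxPartition-irrelevant : ∀ {a b t xs} → Irrelevant (IsBoxPartition a b t xs)
isBoxPartition-irrelevant = ×-irrelevant isPartitionAtMost-irrelevant (All.irrelevant ℕP.≤-irrelevant)

emptyBox-↔ : ∀ {a b} t → (∀ {xs} → IsBoxPartition a b t xs → xs ≡ []) → BoxPartitions a b t ↔ Fin (δ₀ t)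
emptyBox-↔ zero    only[] = mk↔ₛ′ (λ _ → zero) (λ _ → [] , (([] , []) , z≤n , refl) , [])
  (λ { zero → refl }) (λ (xs , p) → Σ-≡-irrelevant isBoxPartition-irrelevant (sym (only[] p)))
emptyBox-↔ (suc t) only[] =
  mk↔ₛ′ (λ (_ , p) → ⊥-elim (nonempty p)) (λ ()) (λ ()) (λ (_ , p) → ⊥-elim (nonempty p))
  where
  nonempty : ∀ {xs} → ¬ IsBoxPartition _ _ (suc t) xs
  nonempty p with only[] p
  nonempty ((_ , _ , ()) , _) | refl

LargestPartIs : ℕ → List ℕ → Set
LargestPartIs v []      = ⊥
LargestPartIs v (x ∷ _) = x ≡ v

largestPartIs-irrelevant : ∀ {v xs} → Irrelevant (LargestPartIs v xs)
largestPartIs-irrelevant {xs = x ∷ _} = ℕP.≡-irrelevant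

isBoxPartition-split :
  ∀ {a b t xs} → IsBoxPartition (suc a) b t xs ↔
                 (IsBoxPartition a b t xs ⊎ (IsBoxPartition (suc a) b t xs × LargestPartIs (suc a) xs))
isBoxPartition-split {a} = irrelevant-↔ isBoxPartition-irrelevant
  (⊎-irrelevant isBoxPartition-irrelevant (×-irrelevant isBoxPartition-irrelevant largestPartIs-irrelevant) disjoint)
  split [ (λ (p , al) → p , All.map ℕP.m≤n⇒m≤1+n al) , proj₁ ]′
  where
  disjoint : ∀ {b t xs} → IsBoxPartition a b t xs → ¬ (IsBoxPartition (suc a) b t xs × LargestPartIs (suc a) xs)
  disjoint (_ , x≤a ∷ _) (_ , refl) = ℕP.<-irrefl refl x≤a
  split : ∀ {b t xs} → IsBoxPartition (suc a) b t xs →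
          IsBoxPartition a b t xs ⊎ (IsBoxPartition (suc a) b t xs × LargestPartIs (suc a) xs)
  split {xs = []}    (p , [])             = inj₁ (p , [])
  split {xs = x ∷ _} (p , x≤1+a ∷ al) with x ≤? a
  ... | yes x≤a = inj₁ (p , x≤a ∷ All.map (λ y≤x → ℕP.≤-trans y≤x x≤a) (decreasing-head (proj₁ (proj₁ p))))
  ... | no  x≰a = inj₂ ((p , x≤1+a ∷ al) , ℕP.≤-antisym x≤1+a (ℕP.≰⇒> x≰a))

removeLargest-↔ : ∀ {a b t} →
  Σ (List ℕ) (λ xs → IsBoxPartition (suc a) (suc b) t xs × LargestPartIs (suc a) xs) ↔
  Σ ℕ (λ u → (suc a + u ≡ t) × BoxPartitions (suc a) b u)
removeLargest-↔ {a} {b} {t} = mk↔ₛ′ to from to∘from from∘to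
  where
  WithLargest Rest : Set
  WithLargest = Σ (List ℕ) (λ xs → IsBoxPartition (suc a) (suc b) t xs × LargestPartIs (suc a) xs)
  Rest        = Σ ℕ (λ u → (suc a + u ≡ t) × BoxPartitions (suc a) b u)
  to : WithLargest → Rest
  to (_ ∷ ys , (((lk , pos) , len , e) , al) , refl) =
    sum ys , e , ys , (((Linked.tail lk , All.tail pos) , ℕP.≤-pred len , refl) , All.tail al)
  from : Rest → WithLargest
  from (u , e , ys , (((lk , pos) , len , refl) , al)) =
    suc a ∷ ys , (((decreasing-cons al lk , s≤s z≤n ∷ pos) , s≤s len , e) , ℕP.≤-refl ∷ al) , refl
  to∘from : ∀ y → to (from y) ≡ y
  to∘from (_ , e , ys , ((_ , _ , refl) , _)) = cong (λ p → sum ys , e , p) (Σ-≡-irrelevant isBoxPartition-irrelevant refl)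
  from∘to : ∀ x → from (to x) ≡ x
  from∘to (_ ∷ _ , _ , refl) =
    Σ-≡-irrelevant (×-irrelevant isBoxPartition-irrelevant (largestPartIs-irrelevant {suc a})) refl

shift-↔ : (A : ℕ → Set) (f : ℕ → ℕ) → (∀ u → A u ↔ Fin (f u)) →
          ∀ i t → Σ ℕ (λ u → (i + u ≡ t) × A u) ↔ Fin (shift 0 i f t)
shift-↔ A f A↔f zero    t       = ↔-trans (mk↔ₛ′ (λ { (_ , refl , x) → x }) (λ x → t , refl , x)
                                            (λ _ → refl) (λ { (_ , refl , _) → refl }))
                                          (A↔f t)
shift-↔ A f A↔f (suc i) zero    = mk↔ₛ′ (λ ()) (λ ()) (λ ()) (λ ())
shift-↔ A f A↔f (suc i) (suc t) = ↔-trans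
  (Σ-congʳ-↔ (mk↔ₛ′ (λ (e , x) → ℕP.suc-injective e , x) (λ (e , x) → cong suc e , x)
                    (λ _ → cong (_, _) (ℕP.≡-irrelevant _ _)) (λ _ → cong (_, _) (ℕP.≡-irrelevant _ _))))
  (shift-↔ A f A↔f i t)

boxPartitions-↔ : ∀ a b t → BoxPartitions a b t ↔ Fin (boxCount a b t)
boxPartitions-↔ zero    b       t = emptyBox-↔ t only[]
  where
  only[] : ∀ {xs} → IsBoxPartition 0 b t xs → xs ≡ []
  only[] {[]}    _                                    = refl
  only[] {_ ∷ _} (((_ , 1≤x ∷ _) , _) , x≤0 ∷ _) = ⊥-elim (ℕP.<-irrefl refl (ℕP.≤-trans 1≤x x≤0))
boxPartitions-↔ (suc a) zero    t = emptyBox-↔ t only[]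
  where
  only[] : ∀ {xs} → IsBoxPartition (suc a) 0 t xs → xs ≡ []
  only[] {[]} _ = refl
  only[] {_ ∷ _} ((_ , () , _) , _)
boxPartitions-↔ (suc a) (suc b) t =
  ↔-trans (Σ-congʳ-↔ isBoxPartition-split)
  (↔-trans Σ-distribˡ-⊎
  (⊎-↔-Fin (boxPartitions-↔ a (suc b) t)
           (↔-trans removeLargest-↔
                    (shift-↔ (BoxPartitions (suc a) b) (boxCount (suc a) b) (boxPartitions-↔ (suc a) b) (suc a) t))))

-- Partitions with i parts exceeding n

countAbove : ℕ → List ℕ → ℕ
countAbove n []       = 0
countAbove n (x ∷ xs) with n <? x
... | yes _ = suc (countAbove n xs)
... | no  _ = countAbove n xs

All≤⇒countAbove≡0 : ∀ n {xs} → All (_≤ n) xs → countAbove n xs ≡ 0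
All≤⇒countAbove≡0 n []                   = refl
All≤⇒countAbove≡0 n {x ∷ _} (x≤n ∷ al) with n <? x
... | yes n<x = ⊥-elim (ℕP.<-irrefl refl (ℕP.<-≤-trans n<x x≤n))
... | no  _   = All≤⇒countAbove≡0 n al

countAbove≡0⇒All≤ : ∀ n xs → countAbove n xs ≡ 0 → All (_≤ n) xs
countAbove≡0⇒All≤ n []       _ = []
countAbove≡0⇒All≤ n (x ∷ xs) c≡0 with n <? x
countAbove≡0⇒All≤ n (x ∷ xs) () | yes _
... | no n≮x = ℕP.≮⇒≥ n≮x ∷ countAbove≡0⇒All≤ n xs c≡0

countAbove*≤sum : ∀ n xs → countAbove n xs * suc n ≤ sum xs
countAbove*≤sum n []       = z≤n
countAbove*≤sum n (x ∷ xs) with n <? x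
... | yes n<x = ℕP.+-mono-≤ n<x (countAbove*≤sum n xs)
... | no  _   = ℕP.≤-trans (countAbove*≤sum n xs) (ℕP.m≤n+m (sum xs) x)

PrefixAbove : ℕ → ℕ → List ℕ → Set
PrefixAbove n i ν = i ≤ length ν × All (n <_) (take i ν) × All (_≤ n) (drop i ν)

countAbove-prefix : ∀ n ν → Decreasing ν → PrefixAbove n (countAbove n ν) ν
countAbove-prefix n []       _  = z≤n , [] , []
countAbove-prefix n (x ∷ ν) lk with n <? x
... | yes n<x = let (c≤l , above , below) = countAbove-prefix n ν (Linked.tail lk) in s≤s c≤l , n<x ∷ above , below
... | no  n≮x = subst (λ c → PrefixAbove n c (x ∷ ν)) (sym (All≤⇒countAbove≡0 n (All.tail below))) (z≤n , [] , below)
  where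
  below : All (_≤ n) (x ∷ ν)
  below = ℕP.≮⇒≥ n≮x ∷ All.map (λ y≤x → ℕP.≤-trans y≤x (ℕP.≮⇒≥ n≮x)) (decreasing-head lk)

addParts : List ℕ → List ℕ → List ℕ
addParts []       ys       = ys
addParts (x ∷ xs) []       = x ∷ xs
addParts (x ∷ xs) (y ∷ ys) = x + y ∷ addParts xs ys

addParts-decreasing : ∀ {xs ys} → Decreasing xs → Decreasing ys → Decreasing (addParts xs ys)
addParts-decreasing {[]}               _            lk′          = lk′
addParts-decreasing {_ ∷ _}  {[]}      lk           _            = lk
addParts-decreasing {_ ∷ []} {_ ∷ []}  _            _            = [-]
addParts-decreasing {x ∷ []} {y ∷ _ ∷ _} _          (y′≤y ∷ lk′) = ℕP.≤-trans y′≤y (ℕP.m≤n+m y x) ∷ lk′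
addParts-decreasing {x ∷ _ ∷ _} {y ∷ []} (x′≤x ∷ lk) _           = ℕP.≤-trans x′≤x (ℕP.m≤m+n x y) ∷ lk
addParts-decreasing {_ ∷ _ ∷ _} {_ ∷ _ ∷ _} (x′≤x ∷ lk) (y′≤y ∷ lk′) =
  ℕP.+-mono-≤ x′≤x y′≤y ∷ addParts-decreasing lk lk′

addParts-positive : ∀ {xs ys} → All (1 ≤_) xs → All (1 ≤_) ys → All (1 ≤_) (addParts xs ys)
addParts-positive {[]}              _          pos′ = pos′
addParts-positive {_ ∷ _} {[]}      pos        _    = pos
addParts-positive {x ∷ _} {y ∷ _}   (1≤x ∷ pos) (_ ∷ pos′) = ℕP.≤-trans 1≤x (ℕP.m≤m+n x y) ∷ addParts-positive pos pos′

addParts-length : ∀ xs ys → length ys ≤ length xs → length (addParts xs ys) ≡ length xs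
addParts-length []       []       _         = refl
addParts-length (_ ∷ _)  []       _         = refl
addParts-length (_ ∷ xs) (_ ∷ ys) (s≤s ≤l)  = cong suc (addParts-length xs ys ≤l)

addParts-sum : ∀ xs ys → sum (addParts xs ys) ≡ sum xs + sum ys
addParts-sum []       ys       = refl
addParts-sum (x ∷ xs) []       = sym (ℕP.+-identityʳ _)
addParts-sum (x ∷ xs) (y ∷ ys) = trans (cong (_+_ (x + y)) (addParts-sum xs ys)) (ℕ+-interchange x y (sum xs) (sum ys))

capLargest : ℕ → ℕ → List ℕ → List ℕ
capLargest n zero    ν       = ν
capLargest n (suc i) []      = []
capLargest n (suc i) (_ ∷ ν) = n ∷ capLargest n i ν

excessLargest : ℕ → ℕ → List ℕ → List ℕ
excessLargest n zero    ν       = []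
excessLargest n (suc i) []      = []
excessLargest n (suc i) (x ∷ ν) = x ∸ n ∷ excessLargest n i ν

capLargest-≤ : ∀ n i ν → All (_≤ n) (drop i ν) → All (_≤ n) (capLargest n i ν)
capLargest-≤ n zero    ν       below = below
capLargest-≤ n (suc i) []      below = []
capLargest-≤ n (suc i) (_ ∷ ν) below = ℕP.≤-refl ∷ capLargest-≤ n i ν below

capLargest-decreasing : ∀ n i ν → Decreasing ν → All (_≤ n) (drop i ν) → Decreasing (capLargest n i ν)
capLargest-decreasing n zero    ν       lk below = lk
capLargest-decreasing n (suc i) []      lk below = []
capLargest-decreasing n (suc i) (_ ∷ ν) lk below =
  decreasing-cons (capLargest-≤ n i ν below) (capLargest-decreasing n i ν (Linked.tail lk) below)

capLargest-positive : ∀ n i ν → 1 ≤ n → All (1 ≤_) ν → All (1 ≤_) (capLargest n i ν)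
capLargest-positive n zero    ν       1≤n pos       = pos
capLargest-positive n (suc i) []      1≤n pos       = []
capLargest-positive n (suc i) (_ ∷ ν) 1≤n (_ ∷ pos) = 1≤n ∷ capLargest-positive n i ν 1≤n pos

capLargest-length : ∀ n i ν → length (capLargest n i ν) ≡ length ν
capLargest-length n zero    ν       = refl
capLargest-length n (suc i) []      = refl
capLargest-length n (suc i) (_ ∷ ν) = cong suc (capLargest-length n i ν)

capLargest-take : ∀ n i ν → All (_≡ n) (take i (capLargest n i ν))
capLargest-take n zero    ν       = []
capLargest-take n (suc i) []      = []
capLargest-take n (suc i) (_ ∷ ν) = refl ∷ capLargest-take n i ν

excessLargest-length : ∀ n i ν → i ≤ length ν → length (excessLargest n i ν) ≡ i
excessLargest-length n zero    ν       _       = refl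
excessLargest-length n (suc i) (_ ∷ ν) (s≤s i≤l) = cong suc (excessLargest-length n i ν i≤l)

excessLargest-positive : ∀ n i ν → All (n <_) (take i ν) → All (1 ≤_) (excessLargest n i ν)
excessLargest-positive n zero    ν       _             = []
excessLargest-positive n (suc i) []      _             = []
excessLargest-positive n (suc i) (_ ∷ ν) (n<x ∷ above) = ℕP.m<n⇒0<n∸m n<x ∷ excessLargest-positive n i ν above

excessLargest-decreasing : ∀ n i ν → Decreasing ν → Decreasing (excessLargest n i ν)
excessLargest-decreasing n zero          ν            _           = []
excessLargest-decreasing n (suc i)       []           _           = []
excessLargest-decreasing n (suc zero)    (_ ∷ ν)      _           = [-]
excessLargest-decreasing n (suc (suc i)) (_ ∷ [])     _           = [-]
excessLargest-decreasing n (suc (suc i)) (_ ∷ x′ ∷ ν) (x′≤x ∷ lk) =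
  ℕP.∸-monoˡ-≤ n x′≤x ∷ excessLargest-decreasing n (suc i) (x′ ∷ ν) lk

capLargest-excessLargest-sum : ∀ n i ν → All (n <_) (take i ν) →
  sum (capLargest n i ν) + sum (excessLargest n i ν) ≡ sum ν
capLargest-excessLargest-sum n zero    ν       _             = ℕP.+-identityʳ _
capLargest-excessLargest-sum n (suc i) []      _             = refl
capLargest-excessLargest-sum n (suc i) (x ∷ ν) (n<x ∷ above) =
  trans (ℕ+-interchange n (sum (capLargest n i ν)) (x ∸ n) (sum (excessLargest n i ν)))
        (cong₂ _+_ (ℕP.m+[n∸m]≡n (ℕP.<⇒≤ n<x)) (capLargest-excessLargest-sum n i ν above))

addParts-capLargest-excessLargest : ∀ n i ν → All (n <_) (take i ν) →
  addParts (capLargest n i ν) (excessLargest n i ν) ≡ ν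
addParts-capLargest-excessLargest n zero    []      _             = refl
addParts-capLargest-excessLargest n zero    (_ ∷ _) _             = refl
addParts-capLargest-excessLargest n (suc i) []      _             = refl
addParts-capLargest-excessLargest n (suc i) (x ∷ ν) (n<x ∷ above) =
  cong₂ _∷_ (ℕP.m+[n∸m]≡n (ℕP.<⇒≤ n<x)) (addParts-capLargest-excessLargest n i ν above)

capLargest-addParts : ∀ n i λs μs → All (_≡ n) (take i λs) → i ≤ length λs → length μs ≡ i →
  capLargest n i (addParts λs μs) ≡ λs
capLargest-addParts n zero    []       []       _           _         _     = refl
capLargest-addParts n zero    (_ ∷ _)  []       _           _         _     = refl
capLargest-addParts n (suc i) (_ ∷ λs) (_ ∷ μs) (x≡n ∷ top) (s≤s i≤l) refl =
  cong₂ _∷_ (sym x≡n) (capLargest-addParts n i λs μs top i≤l refl)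

excessLargest-addParts : ∀ n i λs μs → All (_≡ n) (take i λs) → i ≤ length λs → length μs ≡ i →
  excessLargest n i (addParts λs μs) ≡ μs
excessLargest-addParts n zero    λs       []       _            _         _    = refl
excessLargest-addParts n (suc i) (_ ∷ λs) (y ∷ μs) (refl ∷ top) (s≤s i≤l) refl =
  cong₂ _∷_ (ℕP.m+n∸m≡n n y) (excessLargest-addParts n i λs μs top i≤l refl)

countAbove-addParts : ∀ n i λs μs → All (_≤ n) λs → All (_≡ n) (take i λs) → i ≤ length λs →
  All (1 ≤_) μs → length μs ≡ i → countAbove n (addParts λs μs) ≡ i
countAbove-addParts n zero    λs       []       below _            _         _          _    =
  All≤⇒countAbove≡0 n (subst (All (_≤ n)) (addParts-[] λs) below)
  where
  addParts-[] : ∀ xs → xs ≡ addParts xs []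
  addParts-[] []      = refl
  addParts-[] (_ ∷ _) = refl
countAbove-addParts n (suc i) (x ∷ λs) (y ∷ μs) (_ ∷ below) (refl ∷ top) (s≤s i≤l) (1≤y ∷ pos) refl with n <? n + y
... | yes _   = cong suc (countAbove-addParts n i λs μs below top i≤l pos refl)
... | no  n≮ = ⊥-elim (n≮ (subst (_≤ n + y) (ℕP.+-comm n 1) (ℕP.+-monoʳ-≤ n 1≤y)))

bad-≡ : ∀ {n k i s} {x y : Bad n k i s} → proj₁ x ≡ proj₁ y → x ≡ y
bad-≡ {x = (λs , μs) , p} {.(λs , μs) , q} refl = cong ((λs , μs) ,_) (
  ×-irrelevant isPartition-irrelevant (×-irrelevant isPartition-irrelevant
  (×-irrelevant ℕP.≡-irrelevant (×-irrelevant ℕP.≤-irrelevant (×-irrelevant (All.irrelevant ℕP.≤-irrelevant)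
  (×-irrelevant ℕP.≤-irrelevant (×-irrelevant (All.irrelevant ℕP.≡-irrelevant) ℕP.≡-irrelevant)))))) p q)

countAbove-↔-Bad : ∀ {n k s i} → 1 ≤ n →
  Σ (List ℕ) (λ ν → IsPartitionAtMost k s ν × countAbove n ν ≡ i) ↔ Bad n k i s
countAbove-↔-Bad {n} {k} {s} {i} 1≤n = mk↔ₛ′ to from to∘from from∘to
  where
  prefix : ∀ {ν} → Decreasing ν → countAbove n ν ≡ i → PrefixAbove n i ν
  prefix {ν} lk c≡i = subst (λ c → PrefixAbove n c ν) c≡i (countAbove-prefix n ν lk)
  to : Σ (List ℕ) (λ ν → IsPartitionAtMost k s ν × countAbove n ν ≡ i) → Bad n k i s
  to (ν , ((lk , pos) , len , e) , c≡i) =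
    let (i≤l , above , below) = prefix lk c≡i in
    (capLargest n i ν , excessLargest n i ν) ,
    (capLargest-decreasing n i ν lk below , capLargest-positive n i ν 1≤n pos) ,
    (excessLargest-decreasing n i ν lk , excessLargest-positive n i ν above) ,
    trans (capLargest-excessLargest-sum n i ν above) e ,
    subst (_≤ k) (sym (capLargest-length n i ν)) len ,
    capLargest-≤ n i ν below ,
    subst (i ≤_) (sym (capLargest-length n i ν)) i≤l ,
    capLargest-take n i ν ,
    excessLargest-length n i ν i≤l
  from : Bad n k i s → Σ (List ℕ) (λ ν → IsPartitionAtMost k s ν × countAbove n ν ≡ i)
  from ((λs , μs) , (lkλ , posλ) , (lkμ , posμ) , e , lenλ , below , i≤l , top , lenμ) =
    addParts λs μs ,
    ((addParts-decreasing lkλ lkμ , addParts-positive posλ posμ) ,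
     subst (_≤ k) (sym (addParts-length λs μs (subst (_≤ length λs) (sym lenμ) i≤l))) lenλ ,
     trans (addParts-sum λs μs) e) ,
    countAbove-addParts n i λs μs below top i≤l posμ lenμ
  to∘from : ∀ y → to (from y) ≡ y
  to∘from ((λs , μs) , _ , _ , _ , _ , _ , i≤l , top , lenμ) =
    bad-≡ (cong₂ _,_ (capLargest-addParts n i λs μs top i≤l lenμ) (excessLargest-addParts n i λs μs top i≤l lenμ))
  from∘to : ∀ x → from (to x) ≡ x
  from∘to (ν , ((lk , _) , _) , c≡i) =
    Σ-≡-irrelevant (×-irrelevant isPartitionAtMost-irrelevant ℕP.≡-irrelevant)
                   (addParts-capLargest-excessLargest n i ν (proj₁ (proj₂ (prefix lk c≡i))))

countAbove≡0-↔ : ∀ n {xs} → countAbove n xs ≡ 0 ↔ All (_≤ n) xs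
countAbove≡0-↔ n {xs} = irrelevant-↔ ℕP.≡-irrelevant (All.irrelevant ℕP.≤-irrelevant)
                                     (countAbove≡0⇒All≤ n xs) (All≤⇒countAbove≡0 n)

*-suc-≤⇒≤ : ∀ {c m n j} → j < n → c * suc n ≤ m * n + j → c ≤ m
*-suc-≤⇒≤ {c} {m} {n} {j} j<n c[1+n]≤mn+j = ℕP.≤-pred (ℕP.*-cancelʳ-< (suc n) c (suc m)
  (ℕP.≤-<-trans c[1+n]≤mn+j (ℕP.<-≤-trans (ℕP.+-monoʳ-< (m * n) j<n) mn+n≤[1+m][1+n])))
  where
  mn+n≤[1+m][1+n] : m * n + n ≤ suc m * suc n
  mn+n≤[1+m][1+n] = subst (_≤ suc m * suc n) (ℕP.+-comm n (m * n)) (ℕP.*-monoʳ-≤ (suc m) (ℕP.n≤1+n n))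

countAbove-≤ : ∀ {n m j ν} → j < n → sum ν ≡ m * n + j → countAbove n ν ≤ m
countAbove-≤ {n} {ν = ν} j<n e = *-suc-≤⇒≤ j<n (subst (countAbove n ν * suc n ≤_) e (countAbove*≤sum n ν))

partitionsAtMost-↔ : ∀ n k m j → 1 ≤ n → j < n → (f : ℕ → ℕ) →
  BoxPartitions n k (m * n + j) ↔ Fin (f 0) →
  (∀ i → 1 ≤ i → i ≤ m → Bad n k i (m * n + j) ↔ Fin (f i)) →
  PartitionsAtMost k (m * n + j) ↔ Fin (sumUpTo m f)
partitionsAtMost-↔ n k m j 1≤n j<n f box↔ bad↔ =
  ↔-trans (Σ-congʳ-↔ λ {ν} → irrelevant-↔ isPartitionAtMost-irrelevant
                                           (×-irrelevant isPartitionAtMost-irrelevant ℕP.≤-irrelevant)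
                                           (λ p@(_ , _ , e) → p , countAbove-≤ {ν = ν} j<n e) proj₁)
          (Σ-classes-↔ (countAbove n) f m classes)
  where
  classes : ∀ i → i ≤ m → Σ (List ℕ) (λ ν → IsPartitionAtMost k (m * n + j) ν × countAbove n ν ≡ i) ↔ Fin (f i)
  classes zero    _   = ↔-trans (Σ-congʳ-↔ (↔-refl ×-↔ countAbove≡0-↔ n)) box↔
  classes (suc i) i≤m = ↔-trans (countAbove-↔-Bad 1≤n) (bad↔ (suc i) (s≤s z≤n) i≤m)

sumUpTo-sum1to : ∀ m f → + sumUpTo m f ≡ + f 0 ℤ.+ sum1to m (λ i → + f i)
sumUpTo-sum1to zero    f = sym (ℤP.+-identityʳ (+ f 0))
sumUpTo-sum1to (suc m) f = trans (ℤP.pos-+ (sumUpTo m f) (f (suc m)))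
  (trans (cong (ℤ._+ + f (suc m)) (sumUpTo-sum1to m f)) (ℤP.+-assoc (+ f 0) (sum1to m (λ i → + f i)) (+ f (suc m))))

sum1to-cong : ∀ m {f g : ℕ → ℤ} → (∀ i → f (suc i) ≡ g (suc i)) → sum1to m f ≡ sum1to m g
sum1to-cong zero    f≡g = refl
sum1to-cong (suc m) f≡g = cong₂ ℤ._+_ (sum1to-cong m f≡g) (f≡g m)

lemma4p2 : (n k m j : ℕ) → 1 ≤ n → 1 ≤ k → j < n →
    (G : Series) → IsGaussian (n + k) k G →
    (p : ℕ) → PartitionsAtMost k (m * n + j) ↔ Fin p →
    (b : ℕ → ℕ) → (∀ i → 1 ≤ i → i ≤ m → Bad n k i (m * n + j) ↔ Fin (b i)) →
    G (m * n + j) ≡ (+ p) - sum1to m (λ i → + b i)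
lemma4p2 n k m j 1≤n _ j<n G isG p partitions↔p b bad↔b = begin
  G s                           ≡⟨ gaussian≗boxSeries n k G isG s ⟩
  + boxCount n k s              ≡⟨ x≈z//y (+ boxCount n k s) (sum1to m (λ i → + b i)) (+ p) total ⟩
  + p - sum1to m (λ i → + b i)  ∎
  where
  s : ℕ
  s = m * n + j
  classSize : ℕ → ℕ
  classSize zero    = boxCount n k s
  classSize (suc i) = b (suc i)
  p≡ : p ≡ sumUpTo m classSize
  p≡ = ↔⇒≡ (↔-trans (↔-sym partitions↔p)
                    (partitionsAtMost-↔ n k m j 1≤n j<n classSize (boxPartitions-↔ n k s)
                                        λ { (suc i) _ i≤m → bad↔b (suc i) (s≤s z≤n) i≤m }))
  total : + boxCount n k s ℤ.+ sum1to m (λ i → + b i) ≡ + p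
  total = sym (trans (cong +_ p≡) (trans (sumUpTo-sum1to m classSize)
                                         (cong (ℤ._+_ (+ boxCount n k s)) (sum1to-cong m (λ _ → refl)))))
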